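{- Every $E6L5^-$-frame is an $E5L5^-$-frame.
   Context: An $EL5^-$-frame is a tuple $\mathcal F=(W,R,P,E,w_T)$ where: $W$ is a nonempty set; $R$ is a partial order on $W$ with a least element $w_\bot$ such that every $R$-chain has an upper bound in $W$; $R(w):=\{w'\in W: wRw'\}$; $P$ is a set of $R$-upward closed subsets of $W$; $E:W\to\mathcal P(P)$ is such that each $E(w)$ is a filter on $P$ (nonempty; $A,B\in E(w)\Rightarrow A\cap B\in E(w)$; $A\in E(w)$, $A\subseteq B\in P\Rightarrow B\in E(w)$) and $wRw'$ implies $E(w)\subseteq E(w')$; $w_T$ is an $R$-maximal element. Moreover $\varnothing,W\in P$ and for $A,B\in P$ the sets $A\cap B$, $A\cup B$, $A\supset B:=\{w: \forall w'\in R(w)\,(w'\in A\Rightarrow w'\in B)\}$ and $KA:=\{w: A\in E(w)\}$ belong to $P$. An $E4L5^-$-frame is an $EL5^-$-frame such that for all $w\in W$, $A\in P$: $A\in E(w)$ implies $\{w'\in W: A\in E(w')\}\in E(w)$. An $E5L5^-$-frame is an $E4L5^-$-frame such that for all $w\in W$, $A\in P$: if $A\notin E(w')$ for all $w'\in R(w)$, then $\{w''\in W: A\in E(w'')\}\supset\varnothing$ belongs to $E(w)$. An $E6L5^-$-frame is an $EL5^-$-frame with $E(w)=E(w_\bot)$ for all $w\in W$. -}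

module Defs where

open import Level using (0ℓ)
open import Data.Product using (Σ; _×_; _,_)
open import Data.Sum using (_⊎_)
open import Data.Empty using (⊥)
open import Data.Unit using (⊤)
open import Relation.Binary.PropositionalEquality using (_≡_)

Subset : Set → Set₁
Subset W = W → Set

SubsetFamily : Set → Set₁
SubsetFamily W = Subset W → Set

module _ {W : Set} where
  emptyS : Subset W
  emptyS _ = ⊥

  fullS : Subset W
  fullS _ = ⊤

  _⊆S_ : Subset W → Subset W → Set
  A ⊆S B = ∀ w → A w → B w

  _∩S_ : Subset W → Subset W → Subset W
  (A ∩S B) w = A w × B w

  _∪S_ : Subset W → Subset W → Subset W
  (A ∪S B) w = A w ⊎ B w

  impS : (W → W → Set) → Subset W → Subset W → Subset W
  impS R A B w = ∀ w' → R w w' → A w' → B w'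

  KS : (W → SubsetFamily W) → Subset W → Subset W
  KS E A w = E w A

  UpwardClosed : (W → W → Set) → Subset W → Set
  UpwardClosed R A = ∀ w w' → R w w' → A w → A w'

  IsChain : (W → W → Set) → Subset W → Set
  IsChain R C = ∀ x y → C x → C y → R x y ⊎ R y x

  HasUpperBound : (W → W → Set) → Subset W → Set
  HasUpperBound R C = Σ W (λ u → ∀ x → C x → R x u)

record EL5Frame : Set₂ where
  field
    W   : Set
    R   : W → W → Set
    P   : SubsetFamily W
    E   : W → SubsetFamily W
    wT  : W
    wBot : W
    R-refl    : ∀ w → R w w
    R-trans   : ∀ u v w → R u v → R v w → R u w
    R-antisym : ∀ u v → R u v → R v u → u ≡ v
    wBot-least : ∀ w → R wBot w
    chain-ub : ∀ (C : Subset W) → IsChain R C → HasUpperBound R C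
    P-upward : ∀ A → P A → UpwardClosed R A
    E⊆P      : ∀ w A → E w A → P A
    E-nonempty : ∀ w → Σ (Subset W) (λ A → E w A)
    E-meet   : ∀ w A B → E w A → E w B → E w (A ∩S B)
    E-upward : ∀ w A B → E w A → A ⊆S B → P B → E w B
    E-mono   : ∀ w w' → R w w' → ∀ A → E w A → E w' A
    wT-maximal : ∀ w → R wT w → w ≡ wT
    P-empty : P emptyS
    P-full  : P fullS
    P-∩ : ∀ A B → P A → P B → P (A ∩S B)
    P-∪ : ∀ A B → P A → P B → P (A ∪S B)
    P-⊃ : ∀ A B → P A → P B → P (impS R A B)
    P-K : ∀ A → P A → P (KS E A)

module _ (F : EL5Frame) where
  open EL5Frame F

  E4Cond : Set₁
  E4Cond = ∀ w A → P A → E w A → E w (KS E A)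

  E5Cond : Set₁
  E5Cond = ∀ w A → P A → (∀ w' → R w w' → E w' A → ⊥)
             → E w (impS R (KS E A) emptyS)

  E6Cond : Set₁
  E6Cond = ∀ w A → (E w A → E wBot A) × (E wBot A → E w A)

IsE4L5Frame : EL5Frame → Set₁
IsE4L5Frame F = E4Cond F

IsE5L5Frame : EL5Frame → Set₁
IsE5L5Frame F = E4Cond F × E5Cond F

IsE6L5Frame : EL5Frame → Set₁
IsE6L5Frame F = E6Cond F

-- In an E6 frame E is constant, so each K A is either all of W or empty.
-- If A ∈ E(w) then K A = W, which lies in every filter E(w); if A ∉ E(w)
-- then K A = ∅, so K A ⊃ ∅ = W, which again lies in E(w).
module Submission where

open import Defs
open import Data.Product using (_,_; proj₁; proj₂)

module _ (F : EL5Frame) where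
  open EL5Frame F

  E-contains-full : ∀ w B → P B → (∀ v → B v) → E w B
  E-contains-full w B pB allB with E-nonempty w
  ... | A , eA = E-upward w A B eA (λ v _ → allB v) pB

  E6⇒E-constant : E6Cond F → ∀ w w' A → E w A → E w' A
  E6⇒E-constant e6 w w' A eA = proj₂ (e6 w' A) (proj₁ (e6 w A) eA)

  E6⇒E4 : E6Cond F → E4Cond F
  E6⇒E4 e6 w A pA eA =
    E-contains-full w (KS E A) (P-K A pA) (λ v → E6⇒E-constant e6 w v A eA)

  E6⇒E5 : E6Cond F → E5Cond F
  E6⇒E5 e6 w A pA A∉E↑w =
    E-contains-full w (impS R (KS E A) emptyS)
      (P-⊃ (KS E A) emptyS (P-K A pA) P-empty)
      (λ _ u _ A∈Eu → A∉E↑w w (R-refl w) (E6⇒E-constant e6 u w A A∈Eu))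

lemma4p3 : (F : EL5Frame) → IsE6L5Frame F → IsE5L5Frame F
lemma4p3 F e6 = E6⇒E4 F e6 , E6⇒E5 F e6
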